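{- Let $G=(X,Y,E)$ be a convex bipartite graph with $Y$ in convex order and $X$ in lex-convex order, and let $D=\{u_1,\ldots,u_k\}$, $u_1<u_2<\dots<u_k$, be a minimum cardinality red dominating set of $G$. Then: (1) for distinct $u,v\in D$ it is not the case that $left(u)\le left(v)\le right(v)\le right(u)$, i.e. $N(v)\not\subseteq N(u)$; (2) for every pair of consecutive vertices $u<v$ of $D$, $left(u)<left(v)\le right(u)+1\le right(v)$, i.e. $N(u)\cup N(v)$ consists of consecutive vertices of $Y$; (3) for each $u\in D$, $D$ contains at most one vertex $v>u$ with $left(u)<left(v)\le right(u)+1\le right(v)$.
   Context: Graphs are finite, simple, connected. A bipartite graph $G=(X,Y,E)$ is convex if $Y$ can be ordered $y_1<\dots<y_{n_Y}$ so that each $N(x)$, $x\in X$, is a set of consecutive vertices; $left(x)$ and $right(x)$ denote its smallest and largest neighbour, identifying $y_i$ with the index $i$. The order $x_1<\dots<x_{n_X}$ of $X$ is lex-convex if $i<j$ implies $left(x_i)<left(x_j)$, or $left(x_i)=left(x_j)$ and $right(x_i)\le right(x_j)$. A red dominating set is $D\subseteq X$ such that every $y\in Y$ has a neighbour in $D$; minimum cardinality means of smallest possible size. -}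

module Defs where

open import Data.Nat using (ℕ; _+_; _≤_; _<_)
open import Data.Fin using (Fin; toℕ)
open import Data.Fin.Subset using (Subset; _∈_; ∣_∣)
open import Data.Sum using (_⊎_; inj₁; inj₂)
open import Data.Product using (_×_; ∃)
open import Data.Empty using (⊥)
open import Relation.Nullary using (¬_)
open import Relation.Binary.PropositionalEquality using (_≡_; _≢_)
open import Relation.Binary.Construct.Closure.ReflexiveTransitive using (Star)
open import Level using (0ℓ)

-- A bipartite graph G = (X, Y, E) with X = Fin nX, Y = Fin nY (each
-- ordered by the natural order of indices) and E x y meaning xy ∈ E.
BipGraph : ℕ → ℕ → Set₁
BipGraph nX nY = Fin nX → Fin nY → Set

Vertex : ℕ → ℕ → Set
Vertex nX nY = Fin nX ⊎ Fin nY

Adj : ∀ {nX nY} → BipGraph nX nY → Vertex nX nY → Vertex nX nY → Set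
Adj E (inj₁ x) (inj₂ y) = E x y
Adj E (inj₂ y) (inj₁ x) = E x y
Adj E (inj₁ _) (inj₁ _) = ⊥
Adj E (inj₂ _) (inj₂ _) = ⊥

Connected : ∀ {nX nY} → BipGraph nX nY → Set
Connected E = ∀ u v → Star (Adj E) u v

-- The order of Y is a convex order and l, r are left and right:
-- for every x, N(x) = {y | left(x) ≤ y ≤ right(x)}.
LeftRight : ∀ {nX nY} → BipGraph nX nY → (Fin nX → Fin nY) → (Fin nX → Fin nY) → Set
LeftRight E l r = ∀ x y → (E x y → toℕ (l x) ≤ toℕ y × toℕ y ≤ toℕ (r x))
                        × (toℕ (l x) ≤ toℕ y × toℕ y ≤ toℕ (r x) → E x y)

LexConvex : ∀ {nX nY} → (Fin nX → Fin nY) → (Fin nX → Fin nY) → Set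
LexConvex l r = ∀ i j → toℕ i < toℕ j →
  (toℕ (l i) < toℕ (l j)) ⊎ (l i ≡ l j × toℕ (r i) ≤ toℕ (r j))

RedDominating : ∀ {nX nY} → BipGraph nX nY → Subset nX → Set
RedDominating E D = ∀ y → ∃ λ x → x ∈ D × E x y

MinRedDominating : ∀ {nX nY} → BipGraph nX nY → Subset nX → Set
MinRedDominating E D = RedDominating E D × (∀ D′ → RedDominating E D′ → ∣ D ∣ ≤ ∣ D′ ∣)

ConsecutiveIn : ∀ {n} → Subset n → Fin n → Fin n → Set
ConsecutiveIn D u v = u ∈ D × v ∈ D × toℕ u < toℕ v
  × (∀ w → w ∈ D → toℕ u < toℕ w → toℕ w < toℕ v → ⊥)

Chained : ∀ {nX nY} → (Fin nX → Fin nY) → (Fin nX → Fin nY) → Fin nX → Fin nX → Set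
Chained l r u v = toℕ (l u) < toℕ (l v) × toℕ (l v) ≤ toℕ (r u) + 1 × toℕ (r u) + 1 ≤ toℕ (r v)

-- A minimum red dominating set has no redundant vertex, i.e. none whose
-- neighbourhood is already covered by the other members. Each part is
-- proved by exhibiting such a vertex in the bad configuration: a nested
-- neighbourhood; for consecutive u < v, a gap after right(u) whose
-- dominator cannot sit anywhere in the lex-convex order; and for two
-- chained successors v < w of u, the interval of v lies inside
-- N(u) ∪ N(w).
module Submission where

open import Defs
open import Data.Nat using (ℕ; _≤_; _<_; _+_; _≤?_; _<?_)
open import Data.Nat.Properties
  using (+-comm; ≤-trans; ≤-reflexive; <-≤-trans; <⇒≤; <⇒≢; <-irrefl;
         <-cmp; ≰⇒>; ≮⇒≥; m≤n⇒m<n∨m≡n)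
open import Data.Fin using (Fin; toℕ; fromℕ<; _≟_)
open import Data.Fin.Properties using (toℕ-fromℕ<; toℕ-injective; toℕ<n)
open import Data.Fin.Subset using (Subset; _∈_; _-_)
open import Data.Fin.Subset.Properties
  using (p∩q≢∅⇒∣p─q∣<∣p∣; x∈p∩q⁺; x∈⁅x⁆; x∈p∧x≢y⇒x∈p-y)
open import Data.Product using (_×_; _,_; proj₁; proj₂; ∃)
open import Data.Sum using (inj₁; inj₂)
open import Data.Empty using (⊥; ⊥-elim)
open import Function using (_∘_)
open import Relation.Nullary using (¬_; yes; no)
open import Relation.Binary.PropositionalEquality using (_≡_; _≢_; refl; sym; cong; subst)
open import Relation.Binary using (tri<; tri≈; tri>)

m<n⇒m+1≤n : ∀ {m n} → m < n → m + 1 ≤ n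
m<n⇒m+1≤n {m} {n} = subst (_≤ n) (+-comm 1 m)

m+1≤n⇒m<n : ∀ {m n} → m + 1 ≤ n → m < n
m+1≤n⇒m<n {m} {n} = subst (_≤ n) (+-comm m 1)

toℕ-<⇒≢ : ∀ {n} {i j : Fin n} → toℕ i < toℕ j → i ≢ j
toℕ-<⇒≢ i<j = <⇒≢ i<j ∘ cong toℕ

Redundant : ∀ {nX nY} → BipGraph nX nY → Subset nX → Fin nX → Set
Redundant E D v = ∀ y → E v y → ∃ λ x → x ∈ D × x ≢ v × E x y

dominating-minus-redundant : ∀ {nX nY} {E : BipGraph nX nY} {D v}
  → RedDominating E D → Redundant E D v → RedDominating E (D - v)
dominating-minus-redundant {v = v} dom red y with dom y
... | x , x∈D , exy with x ≟ v
...   | no x≢v = x , x∈p∧x≢y⇒x∈p-y x∈D x≢v , exy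
...   | yes refl with red y exy
...     | x′ , x′∈D , x′≢v , ex′y = x′ , x∈p∧x≢y⇒x∈p-y x′∈D x′≢v , ex′y

minimum⇒¬redundant : ∀ {nX nY} {E : BipGraph nX nY} {D v}
  → MinRedDominating E D → v ∈ D → ¬ Redundant E D v
minimum⇒¬redundant {D = D} {v} (dom , minimal) v∈D red =
  <-irrefl refl (<-≤-trans (p∩q≢∅⇒∣p─q∣<∣p∣ D _ (v , x∈p∩q⁺ (v∈D , x∈⁅x⁆ v)))
                           (minimal (D - v) (dominating-minus-redundant dom red)))

module Convex {nX nY} (E : BipGraph nX nY) (l r : Fin nX → Fin nY)
              (leftRight : LeftRight E l r) (lexConvex : LexConvex l r) where

  L R : Fin nX → ℕ
  L x = toℕ (l x)
  R x = toℕ (r x)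

  interval⇒E : ∀ {x y} → L x ≤ toℕ y → toℕ y ≤ R x → E x y
  interval⇒E {x} {y} lx≤y y≤rx = proj₂ (leftRight x y) (lx≤y , y≤rx)

  E⇒left≤ : ∀ {x y} → E x y → L x ≤ toℕ y
  E⇒left≤ {x} {y} = proj₁ ∘ proj₁ (leftRight x y)

  E⇒≤right : ∀ {x y} → E x y → toℕ y ≤ R x
  E⇒≤right {x} {y} = proj₂ ∘ proj₁ (leftRight x y)

  E-widen : ∀ {u v y} → L u ≤ L v → R v ≤ R u → E v y → E u y
  E-widen lu≤lv rv≤ru e = interval⇒E (≤-trans lu≤lv (E⇒left≤ e)) (≤-trans (E⇒≤right e) rv≤ru)

  L-mono : ∀ {i j} → toℕ i ≤ toℕ j → L i ≤ L j
  L-mono {i} {j} i≤j with m≤n⇒m<n∨m≡n i≤j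
  ... | inj₂ i≡j rewrite toℕ-injective i≡j = ≤-reflexive refl
  ... | inj₁ i<j with lexConvex i j i<j
  ...   | inj₁ li<lj = <⇒≤ li<lj
  ...   | inj₂ (li≡lj , _) = ≤-reflexive (cong toℕ li≡lj)

  module Minimum (D : Subset nX) (minimum : MinRedDominating E D) where

    nested⇒redundant : ∀ {u v} → u ∈ D → u ≢ v → L u ≤ L v → R v ≤ R u → Redundant E D v
    nested⇒redundant {u} u∈D u≢v lu≤lv rv≤ru y e = u , u∈D , u≢v , E-widen lu≤lv rv≤ru e

    ¬nested : ∀ {u v} → u ∈ D → v ∈ D → u ≢ v → L u ≤ L v → ¬ (R v ≤ R u)
    ¬nested u∈D v∈D u≢v lu≤lv = minimum⇒¬redundant minimum v∈D ∘ nested⇒redundant u∈D u≢v lu≤lv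

    strictly-increasing : ∀ {u v} → u ∈ D → v ∈ D → toℕ u < toℕ v → L u < L v × R u < R v
    strictly-increasing {u} {v} u∈D v∈D u<v = lu<lv , ≰⇒> (¬nested u∈D v∈D (toℕ-<⇒≢ u<v) (<⇒≤ lu<lv))
      where
      lu<lv : L u < L v
      lu<lv with lexConvex u v u<v
      ... | inj₁ lu<lv = lu<lv
      ... | inj₂ (lu≡lv , ru≤rv) =
        ⊥-elim (¬nested v∈D u∈D (toℕ-<⇒≢ u<v ∘ sym) (≤-reflexive (cong toℕ (sym lu≡lv))) ru≤rv)

    R-mono : ∀ {u v} → u ∈ D → v ∈ D → toℕ u ≤ toℕ v → R u ≤ R v
    R-mono {u} u∈D v∈D u≤v with m≤n⇒m<n∨m≡n u≤v
    ... | inj₁ u<v = <⇒≤ (proj₂ (strictly-increasing u∈D v∈D u<v))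
    ... | inj₂ u≡v rewrite toℕ-injective u≡v = ≤-reflexive refl

    -- The vertex right(u) + 1 exists, as it lies below left(v); its dominator
    -- can be neither ≤ u (right is monotone on D), nor strictly between u and v,
    -- nor ≥ v (left is monotone).
    consecutive⇒no-gap : ∀ {u v} → ConsecutiveIn D u v → L v ≤ R u + 1
    consecutive⇒no-gap {u} {v} (u∈D , v∈D , u<v , between) with L v ≤? R u + 1
    ... | yes lv≤ru+1 = lv≤ru+1
    ... | no lv≰ru+1 = ⊥-elim (no-dominator (proj₁ minimum y))
      where
      gap : R u + 1 < L v
      gap = ≰⇒> lv≰ru+1
      y<nY : R u + 1 < nY
      y<nY = <-≤-trans gap (<⇒≤ (toℕ<n (l v)))
      y : Fin nY
      y = fromℕ< y<nY
      no-dominator : ¬ ∃ (λ w → w ∈ D × E w y)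
      no-dominator (w , w∈D , e) with toℕ w ≤? toℕ u | toℕ w <? toℕ v
      ... | yes w≤u | _ = <-irrefl refl (<-≤-trans ru<rw (R-mono w∈D u∈D w≤u))
        where
        ru<rw : R u < R w
        ru<rw = m+1≤n⇒m<n (subst (_≤ R w) (toℕ-fromℕ< y<nY) (E⇒≤right e))
      ... | no w≰u | yes w<v = between w w∈D (≰⇒> w≰u) w<v
      ... | no _ | no w≮v = <-irrefl refl (<-≤-trans gap (≤-trans (L-mono (≮⇒≥ w≮v)) lw≤ru+1))
        where
        lw≤ru+1 : L w ≤ R u + 1
        lw≤ru+1 = subst (L w ≤_) (toℕ-fromℕ< y<nY) (E⇒left≤ e)

    consecutive⇒chained : ∀ {u v} → ConsecutiveIn D u v → Chained l r u v
    consecutive⇒chained c@(u∈D , v∈D , u<v , _) =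
      let lu<lv , ru<rv = strictly-increasing u∈D v∈D u<v
      in lu<lv , consecutive⇒no-gap c , m<n⇒m+1≤n ru<rv

    -- N(v) is covered by N(u) up to right(u), and by N(w) from right(u) + 1 ≥ left(w) on.
    ¬two-chained : ∀ {u v w} → u ∈ D → v ∈ D → w ∈ D → toℕ v < toℕ w
      → Chained l r u v → Chained l r u w → ⊥
    ¬two-chained {u} {v} {w} u∈D v∈D w∈D v<w (lu<lv , _) (_ , lw≤ru+1 , _) =
      minimum⇒¬redundant minimum v∈D covered
      where
      rv<rw : R v < R w
      rv<rw = proj₂ (strictly-increasing v∈D w∈D v<w)
      covered : Redundant E D v
      covered y e with toℕ y ≤? R u
      ... | yes y≤ru = u , u∈D , toℕ-<⇒≢ lu<lv ∘ cong l ,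
                       interval⇒E (≤-trans (<⇒≤ lu<lv) (E⇒left≤ e)) y≤ru
      ... | no y≰ru = w , w∈D , toℕ-<⇒≢ v<w ∘ sym ,
                      interval⇒E (≤-trans lw≤ru+1 (m<n⇒m+1≤n (≰⇒> y≰ru)))
                                 (≤-trans (E⇒≤right e) (<⇒≤ rv<rw))

    chained-unique : ∀ {u v w} → u ∈ D → v ∈ D → w ∈ D
      → Chained l r u v → Chained l r u w → v ≡ w
    chained-unique {v = v} {w} u∈D v∈D w∈D cv cw with <-cmp (toℕ v) (toℕ w)
    ... | tri< v<w _ _ = ⊥-elim (¬two-chained u∈D v∈D w∈D v<w cv cw)
    ... | tri≈ _ v≡w _ = toℕ-injective v≡w
    ... | tri> _ _ w<v = ⊥-elim (¬two-chained u∈D w∈D v∈D w<v cw cv)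

lemma1 : ∀ {nX nY} (E : BipGraph nX nY) (l r : Fin nX → Fin nY)
    → Connected E → LeftRight E l r → LexConvex l r
    → (D : Subset nX) → MinRedDominating E D
    → (∀ u v → u ∈ D → v ∈ D → u ≢ v
         → ¬ (toℕ (l u) ≤ toℕ (l v) × toℕ (l v) ≤ toℕ (r v) × toℕ (r v) ≤ toℕ (r u)))
      × (∀ u v → ConsecutiveIn D u v → Chained l r u v)
      × (∀ u v w → u ∈ D → v ∈ D → w ∈ D → toℕ u < toℕ v → toℕ u < toℕ w
         → Chained l r u v → Chained l r u w → v ≡ w)
lemma1 E l r _ leftRight lexConvex D minimum =
    (λ u v u∈D v∈D u≢v (lu≤lv , _ , rv≤ru) → ¬nested u∈D v∈D u≢v lu≤lv rv≤ru)
  , (λ u v → consecutive⇒chained)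
  , (λ u v w u∈D v∈D w∈D _ _ → chained-unique u∈D v∈D w∈D)
  where open Convex E l r leftRight lexConvex
        open Minimum D minimum
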